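{- The mapping $[\mathsf{P}]\mapsto[\mathcal{A}_\mathsf{P}]$ is an order-embedding from $(\mathbb{P}_{\mathrm{fin}},\preccurlyeq_c)/\!\equiv_c$ into $\big(D_\omega(\mathbf{\Sigma}^0_1)(\mathcal{P}\omega),\leq_w\big)/\!\equiv_w$.
   Context: Scott domain: $\mathcal{P}\omega$ is the power set of $\omega$ with topology generated by $\mathcal{O}_F=\{x\subseteq\omega\mid F\subseteq x\}$, $F$ finite. $D_\omega(\mathbf{\Sigma}^0_1)(\mathcal{P}\omega)$ is the class of sets $\bigcup\{A_n\setminus\bigcup_{m<n}A_m \mid n \text{ odd}\}$ with $(A_n)_{n<\omega}$ open. $\mathcal{A}\leq_w\mathcal{B}$ iff there is continuous $f:\mathcal{P}\omega\to\mathcal{P}\omega$ with $f^{ -1}[\mathcal{B}]=\mathcal{A}$; $\equiv_w$ is the induced equivalence, quotients ordered by representatives. A 2-colored poset is $\mathsf{P}=(P,\leq_p,\mathrm{col}_p)$, $\mathrm{col}_p:P\to\{0,1\}$. $\mathsf{P}\preccurlyeq_c\mathsf{Q}$ iff there is an order- and color-preserving map $P\to Q$; $\equiv_c$ the induced equivalence. $\cdot\rightarrowtail_c\cdot$ denotes existence of an injective order- and color-preserving map sending immediate predecessors to immediate predecessors. A countable poset is a shrub if (1) there is no injective order-preserving map from $(\omega,\leq)$ into it; (2) every element has finitely many elements below it; (3) it has a minimal element $\bot$; (4) every subset with an upper bound has a least upper bound. $\mathbb{P}_{\mathrm{lay}}$ is the class of countable 2-colored posets whose underlying poset is a shrub,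 with $\mathrm{col}(\bot)=0$, every maximal element of color $1$, and none of $\vee^0_1$ ($a<b$, $a<c$, $b\perp c$, colors of $a,b,c$ being $1,0,0$), $\wedge^1_0$ ($a<c$, $b<c$, $a\perp b$, $\mathrm{col}(c)=1$, $\mathrm{col}(a)=\mathrm{col}(b)=0$), $\mid^1_1$ ($a<b$ both color 1) satisfying $\cdot\rightarrowtail_c\mathsf{P}$. $\mathbb{P}_{\mathrm{fin}}$ is the class of $\mathsf{P}\in\mathbb{P}_{\mathrm{lay}}$ such that every $p\neq\bot$ has finitely many $p'$ with $p\leq_p p'$. $\mathcal{A}_\mathsf{P}$: identify $P$ with some $\alpha\in\omega\cup\{\omega\}$, set $l_p(\bot)=\emptyset$, $l_p(n)=\{k\in P\mid k\leq_p n\}$ for $n\neq\bot$, and $\mathcal{A}_\mathsf{P}=\{l_p(p)\mid \mathrm{col}_p(p)=1\}$. -}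

module Defs where

open import Level using (0ℓ)
open import Data.Nat using (ℕ; zero; suc; _<_; _≤_; _*_; _+_)
open import Data.Nat.Properties using (<-irrefl)

open import Data.Bool using (Bool; true; false)
open import Data.Fin using (Fin; zero; suc)
open import Data.Fin.Properties as FinP using ()
open import Data.List using (List)
open import Data.List.Relation.Unary.All using (All)
open import Data.List.Membership.Propositional using (_∈_)
open import Data.Product using (Σ; Σ-syntax; _×_; _,_; proj₁)
open import Data.Sum using (_⊎_; inj₁; inj₂)
open import Data.Unit using (⊤; tt)
open import Data.Empty using (⊥)
open import Relation.Nullary using (¬_)
open import Relation.Binary.PropositionalEquality using (_≡_; _≢_; refl; isEquivalence; resp₂)
open import Relation.Binary.Structures using (IsPartialOrder; IsPreorder)
open import Function.Bundles using (_⇔_)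
open import Function.Definitions using (Injective)

Pω : Set
Pω = ℕ → Bool

_⊆ᶠ_ : List ℕ → Pω → Set
F ⊆ᶠ x = All (λ n → x n ≡ true) F

Class : Set₁
Class = Pω → Set

Open : Class → Set
Open U = ∀ x → U x → Σ[ F ∈ List ℕ ] (F ⊆ᶠ x × (∀ y → F ⊆ᶠ y → U y))

Continuous : (Pω → Pω) → Set₁
Continuous f = ∀ (U : Class) → Open U → Open (λ x → U (f x))

_≤w_ : Class → Class → Set₁
A ≤w B = Σ[ f ∈ (Pω → Pω) ] (Continuous f × (∀ x → (A x ⇔ B (f x))))

Odd : ℕ → Set
Odd n = Σ[ k ∈ ℕ ] n ≡ 2 * k + 1

InDω : Class → Set₁
InDω A = Σ[ As ∈ (ℕ → Class) ]
           ((∀ n → Open (As n)) ×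
            (∀ x → (A x ⇔ (Σ[ n ∈ ℕ ] (Odd n × As n x × (∀ m → m < n → ¬ As m x))))))

-- 2-colored posets (colour 0 = false, colour 1 = true)

record TwoColPoset (C : Set) : Set₁ where
  field
    _≤ₚ_ : C → C → Set
    isPO : IsPartialOrder _≡_ _≤ₚ_
    col  : C → Bool

open TwoColPoset public

_≼c_ : {C D : Set} → TwoColPoset C → TwoColPoset D → Set
_≼c_ {C} {D} P Q =
  Σ[ h ∈ (C → D) ]
    ((∀ a b → _≤ₚ_ P a b → _≤ₚ_ Q (h a) (h b)) ×
     (∀ a → col Q (h a) ≡ col P a))

_<[_]_ : {C : Set} → C → TwoColPoset C → C → Set
a <[ P ] b = _≤ₚ_ P a b × a ≢ b

ImmPred : {C : Set} → TwoColPoset C → C → C → Set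
ImmPred P a b = a <[ P ] b × (∀ c → a <[ P ] c → c <[ P ] b → ⊥)

_↣c_ : {C D : Set} → TwoColPoset C → TwoColPoset D → Set
_↣c_ {C} {D} P Q =
  Σ[ h ∈ (C → D) ]
    (Injective _≡_ _≡_ h ×
     (∀ a b → _≤ₚ_ P a b → _≤ₚ_ Q (h a) (h b)) ×
     (∀ a → col Q (h a) ≡ col P a) ×
     (∀ a b → ImmPred P a b → ImmPred Q (h a) (h b)))

-- ∨⁰₁ : a < b, a < c, b ⊥ c ; a = 0, b = 1, c = 2 ; colours 1,0,0
leV : Fin 3 → Fin 3 → Set
leV zero _ = ⊤
leV (suc zero) (suc zero) = ⊤
leV (suc zero) zero = ⊥
leV (suc zero) (suc (suc zero)) = ⊥
leV (suc (suc zero)) (suc (suc zero)) = ⊤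
leV (suc (suc zero)) zero = ⊥
leV (suc (suc zero)) (suc zero) = ⊥

-- ∧¹₀ : a < c, b < c, a ⊥ b ; a = 0, b = 1, c = 2 ; colours 0,0,1
leΛ : Fin 3 → Fin 3 → Set
leΛ _ (suc (suc zero)) = ⊤
leΛ zero zero = ⊤
leΛ zero (suc zero) = ⊥
leΛ (suc zero) (suc zero) = ⊤
leΛ (suc zero) zero = ⊥
leΛ (suc (suc zero)) zero = ⊥
leΛ (suc (suc zero)) (suc zero) = ⊥

private
  reflV : ∀ {i j} → i ≡ j → leV i j
  reflV {zero} refl = tt
  reflV {suc zero} refl = tt
  reflV {suc (suc zero)} refl = tt

  transV : ∀ {i j k} → leV i j → leV j k → leV i k
  transV {zero} {zero} {zero} _ _ = tt
  transV {zero} {zero} {(suc zero)} _ _ = tt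
  transV {zero} {zero} {(suc (suc zero))} _ _ = tt
  transV {zero} {(suc zero)} {zero} _ ()
  transV {zero} {(suc zero)} {(suc zero)} _ _ = tt
  transV {zero} {(suc zero)} {(suc (suc zero))} _ ()
  transV {zero} {(suc (suc zero))} {zero} _ ()
  transV {zero} {(suc (suc zero))} {(suc zero)} _ ()
  transV {zero} {(suc (suc zero))} {(suc (suc zero))} _ _ = tt
  transV {(suc zero)} {zero} {zero} () _
  transV {(suc zero)} {zero} {(suc zero)} () _
  transV {(suc zero)} {zero} {(suc (suc zero))} () _
  transV {(suc zero)} {(suc zero)} {zero} _ ()
  transV {(suc zero)} {(suc zero)} {(suc zero)} _ _ = tt
  transV {(suc zero)} {(suc zero)} {(suc (suc zero))} _ ()
  transV {(suc zero)} {(suc (suc zero))} {zero} () _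
  transV {(suc zero)} {(suc (suc zero))} {(suc zero)} () _
  transV {(suc zero)} {(suc (suc zero))} {(suc (suc zero))} () _
  transV {(suc (suc zero))} {zero} {zero} () _
  transV {(suc (suc zero))} {zero} {(suc zero)} () _
  transV {(suc (suc zero))} {zero} {(suc (suc zero))} () _
  transV {(suc (suc zero))} {(suc zero)} {zero} () _
  transV {(suc (suc zero))} {(suc zero)} {(suc zero)} () _
  transV {(suc (suc zero))} {(suc zero)} {(suc (suc zero))} () _
  transV {(suc (suc zero))} {(suc (suc zero))} {zero} _ ()
  transV {(suc (suc zero))} {(suc (suc zero))} {(suc zero)} _ ()
  transV {(suc (suc zero))} {(suc (suc zero))} {(suc (suc zero))} _ _ = tt

  antiV : ∀ {i j} → leV i j → leV j i → i ≡ j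
  antiV {zero} {zero} _ _ = refl
  antiV {zero} {(suc zero)} _ ()
  antiV {zero} {(suc (suc zero))} _ ()
  antiV {(suc zero)} {zero} () _
  antiV {(suc zero)} {(suc zero)} _ _ = refl
  antiV {(suc zero)} {(suc (suc zero))} () _
  antiV {(suc (suc zero))} {zero} () _
  antiV {(suc (suc zero))} {(suc zero)} () _
  antiV {(suc (suc zero))} {(suc (suc zero))} _ _ = refl

  reflΛ : ∀ {i j} → i ≡ j → leΛ i j
  reflΛ {zero} refl = tt
  reflΛ {suc zero} refl = tt
  reflΛ {suc (suc zero)} refl = tt

  transΛ : ∀ {i j k} → leΛ i j → leΛ j k → leΛ i k
  transΛ {zero} {zero} {zero} _ _ = tt
  transΛ {zero} {zero} {(suc zero)} _ ()
  transΛ {zero} {zero} {(suc (suc zero))} _ _ = tt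
  transΛ {zero} {(suc zero)} {zero} () _
  transΛ {zero} {(suc zero)} {(suc zero)} () _
  transΛ {zero} {(suc zero)} {(suc (suc zero))} () _
  transΛ {zero} {(suc (suc zero))} {zero} _ ()
  transΛ {zero} {(suc (suc zero))} {(suc zero)} _ ()
  transΛ {zero} {(suc (suc zero))} {(suc (suc zero))} _ _ = tt
  transΛ {(suc zero)} {zero} {zero} () _
  transΛ {(suc zero)} {zero} {(suc zero)} () _
  transΛ {(suc zero)} {zero} {(suc (suc zero))} () _
  transΛ {(suc zero)} {(suc zero)} {zero} _ ()
  transΛ {(suc zero)} {(suc zero)} {(suc zero)} _ _ = tt
  transΛ {(suc zero)} {(suc zero)} {(suc (suc zero))} _ _ = tt
  transΛ {(suc zero)} {(suc (suc zero))} {zero} _ ()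
  transΛ {(suc zero)} {(suc (suc zero))} {(suc zero)} _ ()
  transΛ {(suc zero)} {(suc (suc zero))} {(suc (suc zero))} _ _ = tt
  transΛ {(suc (suc zero))} {zero} {zero} () _
  transΛ {(suc (suc zero))} {zero} {(suc zero)} () _
  transΛ {(suc (suc zero))} {zero} {(suc (suc zero))} () _
  transΛ {(suc (suc zero))} {(suc zero)} {zero} () _
  transΛ {(suc (suc zero))} {(suc zero)} {(suc zero)} () _
  transΛ {(suc (suc zero))} {(suc zero)} {(suc (suc zero))} () _
  transΛ {(suc (suc zero))} {(suc (suc zero))} {zero} _ ()
  transΛ {(suc (suc zero))} {(suc (suc zero))} {(suc zero)} _ ()
  transΛ {(suc (suc zero))} {(suc (suc zero))} {(suc (suc zero))} _ _ = tt

  antiΛ : ∀ {i j} → leΛ i j → leΛ j i → i ≡ j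
  antiΛ {zero} {zero} _ _ = refl
  antiΛ {zero} {(suc zero)} () _
  antiΛ {zero} {(suc (suc zero))} _ ()
  antiΛ {(suc zero)} {zero} () _
  antiΛ {(suc zero)} {(suc zero)} _ _ = refl
  antiΛ {(suc zero)} {(suc (suc zero))} _ ()
  antiΛ {(suc (suc zero))} {zero} () _
  antiΛ {(suc (suc zero))} {(suc zero)} () _
  antiΛ {(suc (suc zero))} {(suc (suc zero))} _ _ = refl

  colV : Fin 3 → Bool
  colV zero = true
  colV (suc _) = false

  colΛ : Fin 3 → Bool
  colΛ (suc (suc zero)) = true
  colΛ _ = false

PatV : TwoColPoset (Fin 3)
PatV = record
  { _≤ₚ_ = leV
  ; isPO = record
      { isPreorder = record { isEquivalence = isEquivalence ; reflexive = reflV ; trans = transV }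
      ; antisym = antiV }
  ; col = colV }

PatΛ : TwoColPoset (Fin 3)
PatΛ = record
  { _≤ₚ_ = leΛ
  ; isPO = record
      { isPreorder = record { isEquivalence = isEquivalence ; reflexive = reflΛ ; trans = transΛ }
      ; antisym = antiΛ }
  ; col = colΛ }

-- |¹₁ : a < b, both of colour 1 ; a = 0, b = 1 (usual order on Fin 2)
PatI : TwoColPoset (Fin 2)
PatI = record
  { _≤ₚ_ = Data.Fin._≤_
  ; isPO = FinP.≤-isPartialOrder
  ; col = λ _ → true }

-- countable 2-colored posets, carried by an ordinal α ∈ ω ∪ {ω}

data Size : Set where
  fin   : ℕ → Size
  omega : Size

InSz : Size → ℕ → Set
InSz (fin n) k = k < n
InSz omega   k = ⊤

Elt : Size → Set
Elt α = Σ ℕ (InSz α)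

CtblPoset : Set₁
CtblPoset = Σ[ α ∈ Size ] TwoColPoset (Elt α)

FiniteSet : {C : Set} → (C → Set) → Set
FiniteSet {C} S = Σ[ L ∈ List C ] (∀ c → S c → c ∈ L)

module _ {C : Set} (P : TwoColPoset C) where

  UpperBound : (C → Set) → C → Set
  UpperBound S u = ∀ s → S s → _≤ₚ_ P s u

  Maximal : C → Set
  Maximal p = ∀ q → _≤ₚ_ P p q → q ≡ p

  record IsShrub (bot : C) : Set₁ where
    field
      noChain  : ¬ (Σ[ f ∈ (ℕ → C) ] (Injective _≡_ _≡_ f × (∀ m n → m ≤ n → _≤ₚ_ P (f m) (f n))))
      finBelow : ∀ p → FiniteSet (λ q → _≤ₚ_ P q p)
      botMin   : ∀ q → _≤ₚ_ P q bot → q ≡ bot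
      lub      : ∀ (S : C → Set) → Σ C (UpperBound S) →
                   Σ[ l ∈ C ] (UpperBound S l × (∀ u → UpperBound S u → _≤ₚ_ P l u))

  record IsLay (bot : C) : Set₁ where
    field
      shrub  : IsShrub bot
      colBot : col P bot ≡ false
      colMax : ∀ p → Maximal p → col P p ≡ true
      noV    : ¬ (PatV ↣c P)
      noΛ    : ¬ (PatΛ ↣c P)
      noI    : ¬ (PatI ↣c P)

  record IsFin (bot : C) : Set₁ where
    field
      lay      : IsLay bot
      finAbove : ∀ p → p ≢ bot → FiniteSet (λ q → _≤ₚ_ P p q)

InPfin : CtblPoset → Set₁
InPfin (α , P) = Σ[ bot ∈ Elt α ] IsFin P bot

-- l_p(p) as a subset of ω (l_p(⊥) = ∅)
lSet : (P : CtblPoset) → Elt (proj₁ P) → Elt (proj₁ P) → ℕ → Set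
lSet (α , P) bot p k = p ≢ bot × Σ[ ik ∈ InSz α k ] _≤ₚ_ P (k , ik) p

𝒜 : (P : CtblPoset) → Elt (proj₁ P) → Class
𝒜 (α , P) bot x =
  Σ[ p ∈ Elt α ] (col P p ≡ true × (∀ k → ((x k ≡ true) ⇔ lSet (α , P) bot p k)))

-- Everything rests on the lower sets l(p): 𝒜_P is the family of l(p) with p of colour 1, and
-- l(p) ⊆ l(q) iff p ⊑ q.
--
-- 𝒜_P ∈ D_ω(Σ⁰₁): rank each p ≠ ⊥ by the finite number of elements above it. Layer 2k consists of
-- the x strictly containing l(p) for some p ≠ ⊥ of rank k, layer 2k+1 of the x containing l(p) for
-- some p of colour 1 and rank k. Ranks decrease along the order, so x = l(p) meets layer
-- 2 rank(p) + 1 first, while an x outside 𝒜_P meets an even layer first.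
--
-- From P ≼c Q via h to a reduction: f(x) is the union of l(h ⊥), of l(h p) for p ≠ ⊥ with l(p) ⊆ x,
-- and, for p of colour 1 with l(p) ⊊ x, of an "escape" set for h p: l of the cover of h p, or the
-- complement of l(h p) if h p is maximal. For x = l(p) the escapes stay inside l(h p), so
-- f(x) = l(h p); for x ∉ 𝒜_P no f(x) = l(q) is possible, since q would have to be some h p whose
-- escape set escapes l(q).
--
-- From a reduction f to P ≼c Q: σ p is the largest r with l(r) ⊆ f(l(p)). It is monotone and equals
-- the q with f(l(p)) = l(q) when p has colour 1; a colour-0 p with σ p of colour 1 is moved up to the
-- cover of σ p. The forbidden patterns make covers work: because of |¹₁ a colour-1 element has only
-- colour-0 covers, ∨⁰₁ makes its upper cover unique and ∧¹₀ its lower cover.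

module Submission where

open import Defs
open import Level using (0ℓ)
open import Axiom.ExcludedMiddle using (ExcludedMiddle)
open import Data.Bool as Bool using (Bool; true; false; if_then_else_)
open import Data.Empty using (⊥; ⊥-elim)
open import Data.Fin using (Fin; zero; suc)
open import Data.List using (List; []; _∷_; map; _++_; filter)
open import Data.List.Extrema.Nat using (max; xs≤max)
open import Data.List.Membership.Propositional using (_∈_)
open import Data.List.Membership.Propositional.Properties using (∈-map⁺; ∈-filter⁺)
open import Data.List.Relation.Unary.All as All using (All; []; _∷_)
open import Data.List.Relation.Unary.All.Properties using (++⁺; ++⁻ˡ; ++⁻ʳ; all-filter)
open import Data.List.Relation.Unary.Any using (here; there)
open import Data.Nat using (ℕ; zero; suc; _+_; _*_; _<_; _≤_; z≤n; s≤s)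
import Data.Nat.Properties as ℕ
open import Data.Product using (Σ; ∃-syntax; _×_; _,_; proj₁; proj₂)
open import Data.Sum using (_⊎_; inj₁; inj₂)
open import Data.Unit using (tt)
open import Function using (_∘_)
open import Function.Bundles using (_⇔_; mk⇔; Equivalence)
open import Function.Definitions using (Injective)
open import Relation.Binary.PropositionalEquality using (_≡_; _≢_; refl; sym; trans; cong; subst; module ≡-Reasoning)
open import Relation.Binary.Structures using (IsPartialOrder)
open import Relation.Nullary using (¬_; Dec; yes; no; does)
open import Relation.Nullary.Decidable using (dec-true; dec-false; decidable-stable)

true≢false : true ≢ false
true≢false ()

even<odd⇒≤ : ∀ a b → 2 * a < 2 * b + 1 → a ≤ b
even<odd⇒≤ a b 2a<2b+1 = ℕ.*-cancelˡ-≤ 2 (ℕ.m<1+n⇒m≤n (subst (2 * a <_) (ℕ.+-comm (2 * b) 1) 2a<2b+1))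

odd<odd⇒< : ∀ a b → 2 * a + 1 < 2 * b + 1 → a < b
odd<odd⇒< a b lt = ℕ.*-cancelˡ-< 2 a b (ℕ.+-cancelʳ-< 1 (2 * a) (2 * b) lt)

even≢odd : ∀ a b → 2 * a ≢ 2 * b + 1
even≢odd a b e = ℕ.even≢odd a b (trans e (ℕ.+-comm (2 * b) 1))

∈-tail : {C : Set} {r a : C} {L : List C} → r ∈ a ∷ L → r ≢ a → r ∈ L
∈-tail (here r≡a) r≢a = ⊥-elim (r≢a r≡a)
∈-tail (there r∈L) _ = r∈L

eltIndex-injective : ∀ {α} {a b : Elt α} → proj₁ a ≡ proj₁ b → a ≡ b
eltIndex-injective {fin n} {k , k<n} {.k , k<n′} refl = cong (k ,_) (ℕ.<-irrelevant k<n k<n′)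
eltIndex-injective {omega} {k , tt} {.k , tt} refl = refl

ImmPred-irrefl : {C : Set} (P : TwoColPoset C) {a : C} → ¬ ImmPred P a a
ImmPred-irrefl P ((_ , a≢a) , _) = a≢a refl

module Classical (em : ExcludedMiddle 0ℓ) where

  ¬¬-elim : {A : Set} → ¬ ¬ A → A
  ¬¬-elim = decidable-stable em

  ⌊_⌋ : Set → Bool
  ⌊ A ⌋ = does (em {A})

  ⌊⌋-complete : {A : Set} → A → ⌊ A ⌋ ≡ true
  ⌊⌋-complete = dec-true em

  ⌊⌋-sound : {A : Set} → ⌊ A ⌋ ≡ true → A
  ⌊⌋-sound e = ¬¬-elim λ ¬a → true≢false (trans (sym e) (dec-false em ¬a))

  indicator : Set → ℕ
  indicator A = if ⌊ A ⌋ then 1 else 0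

  count : (ℕ → Set) → ℕ → ℕ
  count A zero = 0
  count A (suc N) = indicator (A N) + count A N

  module _ {A B : ℕ → Set} (A⇒B : ∀ j → A j → B j) where

    indicator-mono : ∀ j → indicator (A j) ≤ indicator (B j)
    indicator-mono j with em {A j} | em {B j}
    ... | no _ | _ = z≤n
    ... | yes _ | yes _ = ℕ.≤-refl
    ... | yes a | no ¬b = ⊥-elim (¬b (A⇒B j a))

    count-mono : ∀ N → count A N ≤ count B N
    count-mono zero = z≤n
    count-mono (suc N) = ℕ.+-mono-≤ (indicator-mono N) (count-mono N)

    count-mono-< : ∀ {j} N → j < N → ¬ A j → B j → count A N < count B N
    count-mono-< {j} (suc N) j<1+N ¬aj bj with j ℕ.≟ N
    ... | yes refl = ℕ.+-mono-<-≤ indicator-< (count-mono N)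
      where
      indicator-< : indicator (A j) < indicator (B j)
      indicator-< rewrite dec-false (em {A j}) ¬aj | dec-true (em {B j}) bj = s≤s z≤n
    ... | no j≢N = ℕ.+-mono-≤-< (indicator-mono N) (count-mono-< N (ℕ.≤∧≢⇒< (ℕ.≤-pred j<1+N) j≢N) ¬aj bj)

  module _ {A : ℕ → Set} where

    count-stable : ∀ {N} → (∀ j → A j → j < N) → ∀ d → count A (d + N) ≡ count A N
    count-stable bounded zero = refl
    count-stable {N} bounded (suc d)
      rewrite dec-false (em {A (d + N)}) (λ a → ℕ.<⇒≱ (bounded (d + N) a) (ℕ.m≤n+m N d))
      = count-stable bounded d

    count-bound-irrelevant : ∀ {M N} → (∀ j → A j → j < M) → (∀ j → A j → j < N) → count A M ≡ count A N
    count-bound-irrelevant {M} {N} <M <N = begin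
      count A M        ≡⟨ count-stable <M N ⟨
      count A (N + M)  ≡⟨ cong (count A) (ℕ.+-comm N M) ⟩
      count A (M + N)  ≡⟨ count-stable <N M ⟩
      count A N        ∎
      where open ≡-Reasoning

  module _ {C : Set} {_≼_ : C → C → Set}
           (≼-trans : ∀ {a b c} → a ≼ b → b ≼ c → a ≼ c)
           (≼-antisym : ∀ {a b} → a ≼ b → b ≼ a → a ≡ b) where

    listed⇒minimal : (L : List C) (S : C → Set) → (∀ r → S r → r ∈ L) → ∀ {s} → S s →
                     ∃[ m ] (S m × (∀ r → S r → r ≼ m → r ≡ m))
    listed⇒minimal [] S listed {s} Ss with listed s Ss
    ... | ()
    listed⇒minimal (a ∷ L) S listed Ss with em {S a}
    ... | no ¬Sa = listed⇒minimal L S (λ r Sr → ∈-tail (listed r Sr) λ { refl → ¬Sa Sr }) Ss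
    ... | yes Sa with em {∃[ r ] (S r × r ≼ a × r ≢ a)}
    ...   | no ¬below = a , Sa , λ r Sr r≼a → ¬¬-elim λ r≢a → ¬below (r , Sr , r≼a , r≢a)
    ...   | yes (r , below) with listed⇒minimal L S′ (λ r (Sr , _ , r≢a) → ∈-tail (listed r Sr) r≢a) below
      where
      S′ : C → Set
      S′ r = S r × r ≼ a × r ≢ a
    ...     | m , (Sm , m≼a , m≢a) , m-min = m , Sm , m-min′
      where
      m-min′ : ∀ r → S r → r ≼ m → r ≡ m
      m-min′ r Sr r≼m = m-min r (Sr , ≼-trans r≼m m≼a , λ { refl → m≢a (≼-antisym m≼a r≼m) }) r≼m

_⊆ₚ_ : Pω → Pω → Set
x ⊆ₚ y = ∀ k → x k ≡ true → y k ≡ true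

FinitelyDetermined : (Pω → Pω) → Set
FinitelyDetermined f = ∀ x k → f x k ≡ true → ∃[ F ] (F ⊆ᶠ x × (∀ y → F ⊆ᶠ y → f y k ≡ true))

finitelyDetermined-⊆ᶠ : ∀ {f} → FinitelyDetermined f → ∀ x F → F ⊆ᶠ f x →
                        ∃[ G ] (G ⊆ᶠ x × (∀ y → G ⊆ᶠ y → F ⊆ᶠ f y))
finitelyDetermined-⊆ᶠ det x [] [] = [] , [] , λ _ _ → []
finitelyDetermined-⊆ᶠ det x (k ∷ F) (fxk ∷ F⊆fx)
  with det x k fxk | finitelyDetermined-⊆ᶠ det x F F⊆fx
... | G₁ , G₁⊆x , G₁-nbhd | G₂ , G₂⊆x , G₂-nbhd =
  G₁ ++ G₂ , ++⁺ G₁⊆x G₂⊆x , λ y G⊆y → G₁-nbhd y (++⁻ˡ G₁ G⊆y) ∷ G₂-nbhd y (++⁻ʳ G₁ G⊆y)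

finitelyDetermined⇒continuous : ∀ {f} → FinitelyDetermined f → Continuous f
finitelyDetermined⇒continuous {f} det U U-open x Ufx with U-open (f x) Ufx
... | F , F⊆fx , F-nbhd with finitelyDetermined-⊆ᶠ det x F F⊆fx
...   | G , G⊆x , G-nbhd = G , G⊆x , λ y G⊆y → F-nbhd (f y) (G-nbhd y G⊆y)

continuous⇒monotone : ∀ {f} → Continuous f → ∀ {x y} → x ⊆ₚ y → f x ⊆ₚ f y
continuous⇒monotone {f} cont {x} {y} x⊆y k fxk with cont (λ z → z k ≡ true) k∈-open x fxk
  where
  k∈-open : Open (λ z → z k ≡ true)
  k∈-open z zk = k ∷ [] , zk ∷ [] , λ { w (wk ∷ []) → wk }
... | F , F⊆x , F-nbhd = F-nbhd y (All.map (λ {j} → x⊆y j) F⊆x)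

module TwoColoured {C : Set} (P : TwoColPoset C) where

  _⊑_ _⊏_ _⋖_ : C → C → Set
  _⊑_ = _≤ₚ_ P
  a ⊏ b = a <[ P ] b
  _⋖_ = ImmPred P

  open IsPartialOrder (isPO P) public
    using () renaming (refl to ⊑-refl; trans to ⊑-trans; antisym to ⊑-antisym)

  ⋖⇒⊑ : ∀ {a b} → a ⋖ b → a ⊑ b
  ⋖⇒⊑ ((a⊑b , _) , _) = a⊑b

  ⋖⇒≢ : ∀ {a b} → a ⋖ b → a ≢ b
  ⋖⇒≢ ((_ , a≢b) , _) = a≢b

  I-pattern : ∀ {a b} → a ⋖ b → col P a ≡ true → col P b ≡ true → PatI ↣c P
  I-pattern {a} {b} a⋖b col-a col-b = h , h-injective , h-mono , h-col , h-⋖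
    where
    h : Fin 2 → C
    h zero = a
    h (suc zero) = b
    h-injective : Injective _≡_ _≡_ h
    h-injective {zero} {zero} _ = refl
    h-injective {zero} {suc zero} a≡b = ⊥-elim (⋖⇒≢ a⋖b a≡b)
    h-injective {suc zero} {zero} b≡a = ⊥-elim (⋖⇒≢ a⋖b (sym b≡a))
    h-injective {suc zero} {suc zero} _ = refl
    h-mono : ∀ i j → _≤ₚ_ PatI i j → h i ⊑ h j
    h-mono zero zero _ = ⊑-refl
    h-mono zero (suc zero) _ = ⋖⇒⊑ a⋖b
    h-mono (suc zero) (suc zero) _ = ⊑-refl
    h-col : ∀ i → col P (h i) ≡ col PatI i
    h-col zero = col-a
    h-col (suc zero) = col-b
    h-⋖ : ∀ i j → ImmPred PatI i j → h i ⋖ h j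
    h-⋖ zero (suc zero) _ = a⋖b
    h-⋖ zero zero i⋖i = ⊥-elim (ImmPred-irrefl PatI i⋖i)
    h-⋖ (suc zero) (suc zero) i⋖i = ⊥-elim (ImmPred-irrefl PatI i⋖i)
    h-⋖ (suc zero) zero ((() , _) , _)

  triple : C → C → C → Fin 3 → C
  triple a b c zero = a
  triple a b c (suc zero) = b
  triple a b c (suc (suc zero)) = c

  triple-injective : ∀ {a b c} → a ≢ b → a ≢ c → b ≢ c → Injective _≡_ _≡_ (triple a b c)
  triple-injective a≢b a≢c b≢c {zero} {zero} _ = refl
  triple-injective a≢b a≢c b≢c {zero} {suc zero} e = ⊥-elim (a≢b e)
  triple-injective a≢b a≢c b≢c {zero} {suc (suc zero)} e = ⊥-elim (a≢c e)
  triple-injective a≢b a≢c b≢c {suc zero} {zero} e = ⊥-elim (a≢b (sym e))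
  triple-injective a≢b a≢c b≢c {suc zero} {suc zero} _ = refl
  triple-injective a≢b a≢c b≢c {suc zero} {suc (suc zero)} e = ⊥-elim (b≢c e)
  triple-injective a≢b a≢c b≢c {suc (suc zero)} {zero} e = ⊥-elim (a≢c (sym e))
  triple-injective a≢b a≢c b≢c {suc (suc zero)} {suc zero} e = ⊥-elim (b≢c (sym e))
  triple-injective a≢b a≢c b≢c {suc (suc zero)} {suc (suc zero)} _ = refl

  V-pattern : ∀ {a b c} → a ⋖ b → a ⋖ c → ¬ b ⊑ c →
              col P a ≡ true → col P b ≡ false → col P c ≡ false → PatV ↣c P
  V-pattern {a} {b} {c} a⋖b a⋖c b⋢c col-a col-b col-c =
    h , triple-injective (⋖⇒≢ a⋖b) (⋖⇒≢ a⋖c) (λ { refl → b⋢c ⊑-refl }) , h-mono , h-col , h-⋖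
    where
    h : Fin 3 → C
    h = triple a b c
    h-mono : ∀ i j → _≤ₚ_ PatV i j → h i ⊑ h j
    h-mono zero zero _ = ⊑-refl
    h-mono zero (suc zero) _ = ⋖⇒⊑ a⋖b
    h-mono zero (suc (suc zero)) _ = ⋖⇒⊑ a⋖c
    h-mono (suc zero) (suc zero) _ = ⊑-refl
    h-mono (suc (suc zero)) (suc (suc zero)) _ = ⊑-refl
    h-mono (suc zero) zero ()
    h-mono (suc zero) (suc (suc zero)) ()
    h-mono (suc (suc zero)) zero ()
    h-mono (suc (suc zero)) (suc zero) ()
    h-col : ∀ i → col P (h i) ≡ col PatV i
    h-col zero = col-a
    h-col (suc zero) = col-b
    h-col (suc (suc zero)) = col-c
    h-⋖ : ∀ i j → ImmPred PatV i j → h i ⋖ h j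
    h-⋖ zero (suc zero) _ = a⋖b
    h-⋖ zero (suc (suc zero)) _ = a⋖c
    h-⋖ zero zero i⋖i = ⊥-elim (ImmPred-irrefl PatV i⋖i)
    h-⋖ (suc zero) (suc zero) i⋖i = ⊥-elim (ImmPred-irrefl PatV i⋖i)
    h-⋖ (suc (suc zero)) (suc (suc zero)) i⋖i = ⊥-elim (ImmPred-irrefl PatV i⋖i)
    h-⋖ (suc zero) zero ((() , _) , _)
    h-⋖ (suc zero) (suc (suc zero)) ((() , _) , _)
    h-⋖ (suc (suc zero)) zero ((() , _) , _)
    h-⋖ (suc (suc zero)) (suc zero) ((() , _) , _)

  Λ-pattern : ∀ {a b c} → a ⋖ c → b ⋖ c → ¬ a ⊑ b →
              col P a ≡ false → col P b ≡ false → col P c ≡ true → PatΛ ↣c P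
  Λ-pattern {a} {b} {c} a⋖c b⋖c a⋢b col-a col-b col-c =
    h , triple-injective (λ { refl → a⋢b ⊑-refl }) (⋖⇒≢ a⋖c) (⋖⇒≢ b⋖c) , h-mono , h-col , h-⋖
    where
    h : Fin 3 → C
    h = triple a b c
    h-mono : ∀ i j → _≤ₚ_ PatΛ i j → h i ⊑ h j
    h-mono zero zero _ = ⊑-refl
    h-mono zero (suc (suc zero)) _ = ⋖⇒⊑ a⋖c
    h-mono (suc zero) (suc zero) _ = ⊑-refl
    h-mono (suc zero) (suc (suc zero)) _ = ⋖⇒⊑ b⋖c
    h-mono (suc (suc zero)) (suc (suc zero)) _ = ⊑-refl
    h-mono zero (suc zero) ()
    h-mono (suc zero) zero ()
    h-mono (suc (suc zero)) zero ()
    h-mono (suc (suc zero)) (suc zero) ()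
    h-col : ∀ i → col P (h i) ≡ col PatΛ i
    h-col zero = col-a
    h-col (suc zero) = col-b
    h-col (suc (suc zero)) = col-c
    h-⋖ : ∀ i j → ImmPred PatΛ i j → h i ⋖ h j
    h-⋖ zero (suc (suc zero)) _ = a⋖c
    h-⋖ (suc zero) (suc (suc zero)) _ = b⋖c
    h-⋖ zero zero i⋖i = ⊥-elim (ImmPred-irrefl PatΛ i⋖i)
    h-⋖ (suc zero) (suc zero) i⋖i = ⊥-elim (ImmPred-irrefl PatΛ i⋖i)
    h-⋖ (suc (suc zero)) (suc (suc zero)) i⋖i = ⊥-elim (ImmPred-irrefl PatΛ i⋖i)
    h-⋖ zero (suc zero) ((() , _) , _)
    h-⋖ (suc zero) zero ((() , _) , _)
    h-⋖ (suc (suc zero)) zero ((() , _) , _)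
    h-⋖ (suc (suc zero)) (suc zero) ((() , _) , _)

module ShrubFacts (em : ExcludedMiddle 0ℓ) {C : Set} (P : TwoColPoset C) {bot : C}
                  (shrub : IsShrub P bot) where

  open Classical em
  open TwoColoured P public
  open IsShrub shrub public

  bot-least : ∀ q → bot ⊑ q
  bot-least q with lub (λ _ → ⊥) (q , λ _ ())
  ... | l , _ , l-least = subst (_⊑ q) (botMin l (l-least bot λ _ ())) (l-least q λ _ ())

  ⊑-≢bot : ∀ {p q} → p ⊑ q → p ≢ bot → q ≢ bot
  ⊑-≢bot {p} p⊑q p≢bot refl = p≢bot (botMin p p⊑q)

  ¬maximal⇒⊏ : ∀ {q} → ¬ Maximal P q → ∃[ r ] (q ⊏ r)
  ¬maximal⇒⊏ {q} ¬max = ¬¬-elim λ ¬above → ¬max λ r q⊑r →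
    ¬¬-elim λ r≢q → ¬above (r , q⊑r , λ q≡r → r≢q (sym q≡r))

  ⋖-above : ∀ {a r} → a ⊏ r → ∃[ s ] (a ⋖ s × s ⊑ r)
  ⋖-above {a} {r} a⊏r
    with listed⇒minimal ⊑-trans ⊑-antisym (proj₁ (finBelow r)) (λ s → a ⊏ s × s ⊑ r)
                        (λ s (_ , s⊑r) → proj₂ (finBelow r) s s⊑r) (a⊏r , ⊑-refl)
  ... | s , (a⊏s , s⊑r) , s-min = s , (a⊏s , nothing-between) , s⊑r
    where
    nothing-between : ∀ c → a ⊏ c → c ⊏ s → ⊥
    nothing-between c a⊏c (c⊑s , c≢s) = c≢s (s-min c (a⊏c , ⊑-trans c⊑s s⊑r) c⊑s)

  ⋖-below : ∀ {p r} → p ⊏ r → ∃[ s ] (s ⋖ r × p ⊑ s)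
  ⋖-below {p} {r} p⊏r
    with listed⇒minimal (λ x y → ⊑-trans y x) (λ x y → ⊑-antisym y x) (proj₁ (finBelow r))
                        (λ s → p ⊑ s × s ⊏ r) (λ s (_ , (s⊑r , _)) → proj₂ (finBelow r) s s⊑r)
                        (⊑-refl , p⊏r)
  ... | s , (p⊑s , s⊏r) , s-max = s , (s⊏r , nothing-between) , p⊑s
    where
    nothing-between : ∀ c → s ⊏ c → c ⊏ r → ⊥
    nothing-between c (s⊑c , s≢c) c⊏r = s≢c (sym (s-max c (⊑-trans p⊑s s⊑c , c⊏r) s⊑c))

  ⋖-squeezeʳ : ∀ {a b c} → a ⋖ c → a ⊏ b → b ⊑ c → b ≡ c
  ⋖-squeezeʳ (_ , nothing-between) a⊏b b⊑c = ¬¬-elim λ b≢c → nothing-between _ a⊏b (b⊑c , b≢c)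

  ⋖-squeezeˡ : ∀ {a b c} → a ⋖ c → a ⊑ b → b ⊏ c → a ≡ b
  ⋖-squeezeˡ (_ , nothing-between) a⊑b b⊏c = ¬¬-elim λ a≢b → nothing-between _ (a⊑b , a≢b) b⊏c

module LayFacts (em : ExcludedMiddle 0ℓ) {C : Set} (P : TwoColPoset C) {bot : C}
                (lay : IsLay P bot) where

  open Classical em
  open IsLay lay public
  open ShrubFacts em P shrub public

  col₁⇒≢bot : ∀ {p} → col P p ≡ true → p ≢ bot
  col₁⇒≢bot col-p refl with trans (sym col-p) colBot
  ... | ()

  ⋖-col₁ˡ : ∀ {a b} → a ⋖ b → col P a ≡ true → col P b ≡ false
  ⋖-col₁ˡ {a} {b} a⋖b col-a with col P b in col-b
  ... | true = ⊥-elim (noI (I-pattern a⋖b col-a col-b))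
  ... | false = refl

  ⋖-col₁ʳ : ∀ {a b} → a ⋖ b → col P b ≡ true → col P a ≡ false
  ⋖-col₁ʳ {a} {b} a⋖b col-b with col P a in col-a
  ... | true = ⊥-elim (noI (I-pattern a⋖b col-a col-b))
  ... | false = refl

  ⋖-unique-above : ∀ {a b c} → col P a ≡ true → a ⋖ b → a ⋖ c → b ≡ c
  ⋖-unique-above {a} {b} {c} col-a a⋖b a⋖c with em {b ⊑ c} | em {c ⊑ b}
  ... | yes b⊑c | _ = ⋖-squeezeʳ a⋖c (proj₁ a⋖b) b⊑c
  ... | no _ | yes c⊑b = sym (⋖-squeezeʳ a⋖b (proj₁ a⋖c) c⊑b)
  ... | no b⋢c | no _ =
        ⊥-elim (noV (V-pattern a⋖b a⋖c b⋢c col-a (⋖-col₁ˡ a⋖b col-a) (⋖-col₁ˡ a⋖c col-a)))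

  ⋖-unique-below : ∀ {a b c} → col P c ≡ true → a ⋖ c → b ⋖ c → a ≡ b
  ⋖-unique-below {a} {b} {c} col-c a⋖c b⋖c with em {a ⊑ b} | em {b ⊑ a}
  ... | yes a⊑b | _ = ⋖-squeezeˡ a⋖c a⊑b (proj₁ b⋖c)
  ... | no _ | yes b⊑a = sym (⋖-squeezeˡ b⋖c b⊑a (proj₁ a⋖c))
  ... | no a⋢b | no _ =
        ⊥-elim (noΛ (Λ-pattern a⋖c b⋖c a⋢b (⋖-col₁ʳ a⋖c col-c) (⋖-col₁ʳ b⋖c col-c) col-c))

  col₁-⋖-⊑ : ∀ {q s r} → col P q ≡ true → q ⋖ s → q ⊏ r → s ⊑ r
  col₁-⋖-⊑ col-q q⋖s q⊏r with ⋖-above q⊏r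
  ... | s′ , q⋖s′ , s′⊑r = subst (_⊑ _) (⋖-unique-above col-q q⋖s′ q⋖s) s′⊑r

  -- If q ∉ S, all of S lies below the unique lower cover of q, a smaller upper bound.
  col₁-lub-∈ : ∀ (S : C → Set) {s₀ q} → S s₀ → UpperBound P S q → (∀ u → UpperBound P S u → q ⊑ u) →
               col P q ≡ true → S q
  col₁-lub-∈ S {s₀} {q} Ss₀ q-ub q-least col-q = ¬¬-elim ¬¬Sq
    where
    below-q : ¬ S q → ∀ {s} → S s → s ⊏ q
    below-q ¬Sq {s} Ss = q-ub s Ss , λ s≡q → ¬Sq (subst S s≡q Ss)
    ¬¬Sq : ¬ ¬ S q
    ¬¬Sq ¬Sq with ⋖-below (below-q ¬Sq Ss₀)
    ... | m , m⋖q , _ = ⋖⇒≢ m⋖q (⊑-antisym (⋖⇒⊑ m⋖q) (q-least m m-ub))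
      where
      m-ub : UpperBound P S m
      m-ub s Ss with ⋖-below (below-q ¬Sq Ss)
      ... | m′ , m′⋖q , s⊑m′ = subst (s ⊑_) (⋖-unique-below col-q m′⋖q m⋖q) s⊑m′

module FinFacts (em : ExcludedMiddle 0ℓ) {C : Set} (P : TwoColPoset C) {bot : C}
                (isFin : IsFin P bot) where

  open Classical em
  open IsFin isFin public
  open LayFacts em P lay public

  maximal-above : ∀ p → p ≢ bot → ∃[ m ] (p ⊑ m × Maximal P m)
  maximal-above p p≢bot
    with listed⇒minimal (λ x y → ⊑-trans y x) (λ x y → ⊑-antisym y x) (proj₁ (finAbove p p≢bot))
                        (p ⊑_) (proj₂ (finAbove p p≢bot)) ⊑-refl
  ... | m , p⊑m , m-max = m , p⊑m , λ q m⊑q → m-max q (⊑-trans p⊑m m⊑q) m⊑q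

  col₁-above : ∀ p → ∃[ m ] (p ⊑ m × col P m ≡ true)
  col₁-above p with em {∃[ q ] (p ⊑ q × q ≢ bot)}
  ... | yes (q , p⊑q , q≢bot) = let m , q⊑m , m-max = maximal-above q q≢bot
                                 in m , ⊑-trans p⊑q q⊑m , colMax m m-max
  ... | no ¬above = ⊥-elim (col₁⇒≢bot (colMax bot bot-maximal) refl)
    where
    p≡bot : p ≡ bot
    p≡bot = ¬¬-elim λ p≢bot → ¬above (p , ⊑-refl , p≢bot)
    bot-maximal : Maximal P bot
    bot-maximal q bot⊑q = ¬¬-elim λ q≢bot → ¬above (q , subst (_⊑ q) (sym p≡bot) bot⊑q , q≢bot)

module Pfin (em : ExcludedMiddle 0ℓ) (α : Size) (P : TwoColPoset (Elt α)) (bot : Elt α)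
            (isFin : IsFin P bot) where

  open Classical em
  open FinFacts em P isFin public

  l : Elt α → ℕ → Set
  l = lSet (α , P) bot

  _⊆ˡ_ : Elt α → Pω → Set
  p ⊆ˡ x = ∀ j → l p j → x j ≡ true

  _⊈ˡ_ : Pω → Elt α → Set
  x ⊈ˡ p = ∃[ j ] (x j ≡ true × ¬ l p j)

  _≐ˡ_ : Pω → Elt α → Set
  x ≐ˡ p = ∀ k → (x k ≡ true) ⇔ l p k

  ≐ˡ⇒⊆ˡ : ∀ {x p} → x ≐ˡ p → p ⊆ˡ x
  ≐ˡ⇒⊆ˡ x≐p k = Equivalence.from (x≐p k)

  l-self : ∀ {p} → p ≢ bot → l p (proj₁ p)
  l-self {p} p≢bot = p≢bot , proj₂ p , ⊑-refl

  l-⊑ : ∀ {q} r → l q (proj₁ r) → r ⊑ q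
  l-⊑ {q} r (_ , _ , r⊑q) = subst (_⊑ q) (eltIndex-injective refl) r⊑q

  l-⊆⇒⊑ : ∀ {p q} → p ≢ bot → (∀ k → l p k → l q k) → p ⊑ q
  l-⊆⇒⊑ {p} p≢bot lp⊆lq = l-⊑ p (lp⊆lq _ (l-self p≢bot))

  l-mono : ∀ {p q k} → p ⊑ q → l p k → l q k
  l-mono p⊑q (p≢bot , k∈α , k⊑p) = ⊑-≢bot p⊑q p≢bot , k∈α , ⊑-trans k⊑p p⊑q

  ≐ˡ-unique : ∀ {x p q} → q ≢ bot → x ≐ˡ p → x ≐ˡ q → p ≡ q
  ≐ˡ-unique {x} {p} {q} q≢bot x≐p x≐q = ⊑-antisym (l-⊆⇒⊑ p≢bot lp⊆lq) (l-⊆⇒⊑ q≢bot lq⊆lp)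
    where
    lp⊆lq : ∀ k → l p k → l q k
    lp⊆lq k = Equivalence.to (x≐q k) ∘ Equivalence.from (x≐p k)
    lq⊆lp : ∀ k → l q k → l p k
    lq⊆lp k = Equivalence.to (x≐p k) ∘ Equivalence.from (x≐q k)
    p≢bot : p ≢ bot
    p≢bot = proj₁ (lq⊆lp _ (l-self q≢bot))

  ⊆ˡ-col₁⇒⊈ˡ : ∀ {x p} → ¬ 𝒜 (α , P) bot x → col P p ≡ true → p ⊆ˡ x → x ⊈ˡ p
  ⊆ˡ-col₁⇒⊈ˡ x∉𝒜 col-p p⊆x = ¬¬-elim λ x⊆p →
    x∉𝒜 (_ , col-p , λ j → mk⇔ (λ xj → ¬¬-elim λ j∉lp → x⊆p (j , xj , j∉lp)) (p⊆x j))

  ↓-indices : Elt α → List ℕ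
  ↓-indices p = map proj₁ (proj₁ (finBelow p))

  ∈-↓-indices : ∀ {p j} → l p j → j ∈ ↓-indices p
  ∈-↓-indices (_ , j∈α , j⊑p) = ∈-map⁺ proj₁ (proj₂ (finBelow _) (_ , j∈α) j⊑p)

  ⊆ˡ-finitary : ∀ {p x} → p ⊆ˡ x → ∃[ F ] (F ⊆ᶠ x × (∀ y → F ⊆ᶠ y → p ⊆ˡ y))
  ⊆ˡ-finitary {p} {x} p⊆x =
    filter x? (↓-indices p) , all-filter x? (↓-indices p) ,
    λ y F⊆y j lj → All.lookup F⊆y (∈-filter⁺ x? (∈-↓-indices lj) (p⊆x j lj))
    where
    x? : ∀ j → Dec (x j ≡ true)
    x? j = x j Bool.≟ true

  l-missing : ∀ q → ∃[ k ] ¬ l q k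
  l-missing q = suc (max 0 (↓-indices q)) ,
                λ lk → ℕ.<-irrefl refl (All.lookup (xs≤max 0 (↓-indices q)) (∈-↓-indices lk))

  Above : Elt α → ℕ → Set
  Above p j = ∃[ j∈α ] (p ⊑ (j , j∈α))

  bound : Elt α → ℕ
  bound p with em {p ≡ bot}
  ... | yes _ = 0
  ... | no p≢bot = suc (max 0 (map proj₁ (proj₁ (finAbove p p≢bot))))

  bound-spec : ∀ {p} → p ≢ bot → ∀ j → Above p j → j < bound p
  bound-spec {p} p≢bot j (_ , p⊑j) with em {p ≡ bot}
  ... | yes p≡bot = ⊥-elim (p≢bot p≡bot)
  ... | no p≢bot′ = s≤s (All.lookup (xs≤max 0 _) (∈-map⁺ proj₁ (proj₂ (finAbove p p≢bot′) _ p⊑j)))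

  -- The number of elements above p (all of index below bound p); rank bot is junk.
  rank : Elt α → ℕ
  rank p = count (Above p) (bound p)

  rank-anti : ∀ {p q} → p ≢ bot → p ⊏ q → rank q < rank p
  rank-anti {p} {q} p≢bot (p⊑q , p≢q) = begin-strict
    rank q                     ≡⟨ count-bound-irrelevant (bound-spec (⊑-≢bot p⊑q p≢bot)) ↑q<bound-p ⟩
    count (Above q) (bound p)  <⟨ count-mono-< ↑q⊆↑p (bound p) (bound-spec p≢bot _ p∈↑p) p∉↑q p∈↑p ⟩
    rank p                     ∎
    where
    open ℕ.≤-Reasoning
    ↑q⊆↑p : ∀ j → Above q j → Above p j
    ↑q⊆↑p j (j∈α , q⊑j) = j∈α , ⊑-trans p⊑q q⊑j
    ↑q<bound-p : ∀ j → Above q j → j < bound p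
    ↑q<bound-p j q⊑j = bound-spec p≢bot j (↑q⊆↑p j q⊑j)
    p∈↑p : Above p (proj₁ p)
    p∈↑p = proj₂ p , ⊑-refl
    p∉↑q : ¬ Above q (proj₁ p)
    p∉↑q (_ , q⊑p) = p≢q (⊑-antisym p⊑q (subst (q ⊑_) (eltIndex-injective refl) q⊑p))

  rank-anti-⊑ : ∀ {p q} → p ≢ bot → p ⊑ q → rank q ≤ rank p
  rank-anti-⊑ {p} {q} p≢bot p⊑q with em {p ≡ q}
  ... | yes refl = ℕ.≤-refl
  ... | no p≢q = ℕ.<⇒≤ (rank-anti p≢bot (p⊑q , p≢q))

  ExceedsRank : ℕ → Class
  ExceedsRank k x = ∃[ p ] (p ≢ bot × rank p ≡ k × p ⊆ˡ x × x ⊈ˡ p)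

  ReachesRank : ℕ → Class
  ReachesRank k x = ∃[ p ] (col P p ≡ true × rank p ≡ k × p ⊆ˡ x)

  layer : ℕ → Class
  layer n x = ∃[ k ] ((n ≡ 2 * k × ExceedsRank k x) ⊎ (n ≡ 2 * k + 1 × ReachesRank k x))

  layer-open : ∀ n → Open (layer n)
  layer-open n x (k , inj₁ (n≡2k , p , p≢bot , rank-p , p⊆x , (j , xj , j∉lp))) with ⊆ˡ-finitary p⊆x
  ... | F , F⊆x , F-nbhd = j ∷ F , xj ∷ F⊆x ,
        λ { y (yj ∷ F⊆y) → k , inj₁ (n≡2k , p , p≢bot , rank-p , F-nbhd y F⊆y , (j , yj , j∉lp)) }
  layer-open n x (k , inj₂ (n≡2k+1 , p , col-p , rank-p , p⊆x)) with ⊆ˡ-finitary p⊆x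
  ... | F , F⊆x , F-nbhd = F , F⊆x , λ y F⊆y → k , inj₂ (n≡2k+1 , p , col-p , rank-p , F-nbhd y F⊆y)

  FirstLayerOdd : Pω → Set
  FirstLayerOdd x = ∃[ n ] (Odd n × layer n x × (∀ m → m < n → ¬ layer m x))

  𝒜⇒first-layer-odd : ∀ {x} → 𝒜 (α , P) bot x → FirstLayerOdd x
  𝒜⇒first-layer-odd {x} (p , col-p , x≐p) =
    2 * rank p + 1 , (rank p , refl) , (rank p , inj₂ (refl , p , col-p , refl , ≐ˡ⇒⊆ˡ x≐p)) , no-earlier
    where
    ⊆ˡx⇒⊑p : ∀ {p′} → p′ ≢ bot → p′ ⊆ˡ x → p′ ⊑ p
    ⊆ˡx⇒⊑p p′≢bot p′⊆x = l-⊆⇒⊑ p′≢bot (λ k lk → Equivalence.to (x≐p k) (p′⊆x k lk))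
    no-earlier : ∀ m → m < 2 * rank p + 1 → ¬ layer m x
    no-earlier m m< (_ , inj₁ (refl , p′ , p′≢bot , refl , p′⊆x , (j , xj , j∉lp′))) =
      ℕ.<⇒≱ (rank-anti p′≢bot (⊆ˡx⇒⊑p p′≢bot p′⊆x , p′≢p)) (even<odd⇒≤ (rank p′) (rank p) m<)
      where
      p′≢p : p′ ≢ p
      p′≢p refl = j∉lp′ (Equivalence.to (x≐p j) xj)
    no-earlier m m< (_ , inj₂ (refl , p′ , col-p′ , refl , p′⊆x)) =
      ℕ.<⇒≱ (odd<odd⇒< (rank p′) (rank p) m<)
            (rank-anti-⊑ (col₁⇒≢bot col-p′) (⊆ˡx⇒⊑p (col₁⇒≢bot col-p′) p′⊆x))

  first-layer-odd⇒𝒜 : ∀ {x} → FirstLayerOdd x → 𝒜 (α , P) bot x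
  first-layer-odd⇒𝒜 (n , (k , n≡2k+1) , (k′ , inj₁ (n≡2k′ , _)) , _) =
    ⊥-elim (even≢odd k′ k (trans (sym n≡2k′) n≡2k+1))
  first-layer-odd⇒𝒜 (_ , _ , (k , inj₂ (refl , p , col-p , rank-p , p⊆x)) , no-earlier) = ¬¬-elim λ x∉𝒜 →
    no-earlier (2 * k) (ℕ.m<m+n (2 * k) (s≤s z≤n))
               (k , inj₁ (refl , p , col₁⇒≢bot col-p , rank-p , p⊆x , ⊆ˡ-col₁⇒⊈ˡ x∉𝒜 col-p p⊆x))

  𝒜∈Dω : InDω (𝒜 (α , P) bot)
  𝒜∈Dω = layer , layer-open , λ x → mk⇔ 𝒜⇒first-layer-odd first-layer-odd⇒𝒜

module Reduction (em : ExcludedMiddle 0ℓ)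
  (α : Size) (P : TwoColPoset (Elt α)) (botP : Elt α) (isFinP : IsFin P botP)
  (β : Size) (Q : TwoColPoset (Elt β)) (botQ : Elt β) (isFinQ : IsFin Q botQ) where

  open Classical em
  module P = Pfin em α P botP isFinP
  module Q = Pfin em β Q botQ isFinQ

  𝒜P 𝒜Q : Class
  𝒜P = 𝒜 (α , P) botP
  𝒜Q = 𝒜 (β , Q) botQ

  Escape : Elt β → ℕ → Set
  Escape q k = (∃[ s ] (q Q.⋖ s × Q.l s k)) ⊎ (Maximal Q q × ¬ Q.l q k)

  Escape-⊈ : ∀ {q} → col Q q ≡ true → ¬ (∀ k → Escape q k → Q.l q k)
  Escape-⊈ {q} col-q Esc⊆lq with em {Maximal Q q}
  ... | yes q-max = let k , k∉lq = Q.l-missing q in k∉lq (Esc⊆lq k (inj₂ (q-max , k∉lq)))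
  ... | no ¬q-max with Q.⋖-above (proj₂ (Q.¬maximal⇒⊏ ¬q-max))
  ...   | s , q⋖s , _ =
          Q.⋖⇒≢ q⋖s (Q.⊑-antisym (Q.⋖⇒⊑ q⋖s) (Q.l-⊑ s (Esc⊆lq _ (inj₁ (s , q⋖s , Q.l-self s≢bot)))))
    where
    s≢bot : s ≢ botQ
    s≢bot = Q.⊑-≢bot (Q.⋖⇒⊑ q⋖s) (Q.col₁⇒≢bot col-q)

  module FromEmbedding (h : Elt α → Elt β) (h-mono : ∀ a b → a P.⊑ b → h a Q.⊑ h b)
                       (h-col : ∀ a → col Q (h a) ≡ col P a) where

    h-col₁ : ∀ {p} → col P p ≡ true → col Q (h p) ≡ true
    h-col₁ {p} col-p = trans (h-col p) col-p

    -- The cover of p below p₁ has colour 0, so h cannot identify p with p₁.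
    h-strict : ∀ {p p₁} → col P p ≡ true → p P.⊏ p₁ → h p Q.⊏ h p₁
    h-strict {p} {p₁} col-p p⊏p₁ with P.⋖-above p⊏p₁
    ... | s , p⋖s , s⊑p₁ = h-mono p p₁ (proj₁ p⊏p₁) , hp≢hp₁
      where
      hp≢hp₁ : h p ≢ h p₁
      hp≢hp₁ hp≡hp₁ = true≢false (begin
        true         ≡⟨ sym col-p ⟩
        col P p      ≡⟨ sym (h-col p) ⟩
        col Q (h p)  ≡⟨ cong (col Q) (sym hs≡hp) ⟩
        col Q (h s)  ≡⟨ h-col s ⟩
        col P s      ≡⟨ P.⋖-col₁ˡ p⋖s col-p ⟩
        false        ∎)
        where
        open ≡-Reasoning
        hs≡hp : h s ≡ h p
        hs≡hp = Q.⊑-antisym (subst (h s Q.⊑_) (sym hp≡hp₁) (h-mono s p₁ s⊑p₁)) (h-mono p s (P.⋖⇒⊑ p⋖s))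

    Image : Pω → ℕ → Set
    Image x k = Q.l (h botP) k
              ⊎ (∃[ p ] (p ≢ botP × p P.⊆ˡ x × Q.l (h p) k))
              ⊎ (∃[ p ] (col P p ≡ true × p P.⊆ˡ x × x P.⊈ˡ p × Escape (h p) k))

    f : Pω → Pω
    f x k = ⌊ Image x k ⌋

    f-continuous : Continuous f
    f-continuous = finitelyDetermined⇒continuous determined
      where
      determined : FinitelyDetermined f
      determined x k fxk with ⌊⌋-sound {Image x k} fxk
      ... | inj₁ k∈lh⊥ = [] , [] , λ _ _ → ⌊⌋-complete (inj₁ k∈lh⊥)
      ... | inj₂ (inj₁ (p , p≢bot , p⊆x , k∈lhp)) with P.⊆ˡ-finitary p⊆x
      ...   | F , F⊆x , F-nbhd =
              F , F⊆x , λ y F⊆y → ⌊⌋-complete (inj₂ (inj₁ (p , p≢bot , F-nbhd y F⊆y , k∈lhp)))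
      determined x k fxk | inj₂ (inj₂ (p , col-p , p⊆x , (j , xj , j∉lp) , esc)) with P.⊆ˡ-finitary p⊆x
      ...   | F , F⊆x , F-nbhd = j ∷ F , xj ∷ F⊆x ,
              λ { y (yj ∷ F⊆y) →
                    ⌊⌋-complete (inj₂ (inj₂ (p , col-p , F-nbhd y F⊆y , (j , yj , j∉lp) , esc))) }

    f-preserves : ∀ {x} → 𝒜P x → 𝒜Q (f x)
    f-preserves {x} (p₁ , col-p₁ , x≐p₁) =
      h p₁ , h-col₁ col-p₁ ,
      λ k → mk⇔ (λ fxk → image⊆lhp₁ k (⌊⌋-sound fxk))
                (λ k∈lhp₁ →
                   ⌊⌋-complete (inj₂ (inj₁ (p₁ , P.col₁⇒≢bot col-p₁ , P.≐ˡ⇒⊆ˡ x≐p₁ , k∈lhp₁))))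
      where
      ⊆ˡx⇒⊑p₁ : ∀ {p} → p ≢ botP → p P.⊆ˡ x → p P.⊑ p₁
      ⊆ˡx⇒⊑p₁ p≢bot p⊆x = P.l-⊆⇒⊑ p≢bot (λ j lj → Equivalence.to (x≐p₁ j) (p⊆x j lj))
      escape⊆lhp₁ : ∀ {p k} → col P p ≡ true → p P.⊏ p₁ → Escape (h p) k → Q.l (h p₁) k
      escape⊆lhp₁ col-p p⊏p₁ (inj₁ (s , hp⋖s , k∈ls)) =
        Q.l-mono (Q.col₁-⋖-⊑ (h-col₁ col-p) hp⋖s (h-strict col-p p⊏p₁)) k∈ls
      escape⊆lhp₁ col-p p⊏p₁ (inj₂ (hp-max , _)) with h-strict col-p p⊏p₁
      ... | hp⊑hp₁ , hp≢hp₁ = ⊥-elim (hp≢hp₁ (sym (hp-max _ hp⊑hp₁)))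
      image⊆lhp₁ : ∀ k → Image x k → Q.l (h p₁) k
      image⊆lhp₁ k (inj₁ k∈lh⊥) = Q.l-mono (h-mono botP p₁ (P.bot-least p₁)) k∈lh⊥
      image⊆lhp₁ k (inj₂ (inj₁ (p , p≢bot , p⊆x , k∈lhp))) = Q.l-mono (h-mono p p₁ (⊆ˡx⇒⊑p₁ p≢bot p⊆x)) k∈lhp
      image⊆lhp₁ k (inj₂ (inj₂ (p , col-p , p⊆x , (j , xj , j∉lp) , esc))) =
        escape⊆lhp₁ col-p (⊆ˡx⇒⊑p₁ (P.col₁⇒≢bot col-p) p⊆x , p≢p₁) esc
        where
        p≢p₁ : p ≢ p₁
        p≢p₁ refl = j∉lp (Equivalence.to (x≐p₁ j) xj)

    f-reflects : ∀ {x} → 𝒜Q (f x) → 𝒜P x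
    f-reflects {x} (q , col-q , fx≐q) =
      ¬¬-elim λ x∉𝒜P → q∉image x∉𝒜P (lq⊆image _ (Q.l-self (Q.col₁⇒≢bot col-q)))
      where
      image⊆lq : ∀ k → Image x k → Q.l q k
      image⊆lq k k∈fx = Equivalence.to (fx≐q k) (⌊⌋-complete k∈fx)
      lq⊆image : ∀ k → Q.l q k → Image x k
      lq⊆image k k∈lq = ⌊⌋-sound (Equivalence.from (fx≐q k) k∈lq)
      image-part-≡q : ∀ {r} → Q.l r (proj₁ q) → (∀ k → Q.l r k → Image x k) → q ≡ r
      image-part-≡q q∈lr lr⊆image =
        Q.⊑-antisym (Q.l-⊑ q q∈lr) (Q.l-⊆⇒⊑ (proj₁ q∈lr) λ k lk → image⊆lq k (lr⊆image k lk))
      ≢q-col₀ : ∀ {r} → col Q r ≡ false → q ≢ r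
      ≢q-col₀ col-r refl = true≢false (trans (sym col-q) col-r)
      q∉image : ¬ 𝒜P x → ¬ Image x (proj₁ q)
      q∉image _ (inj₁ q∈lh⊥) = ≢q-col₀ (trans (h-col botP) P.colBot) (image-part-≡q q∈lh⊥ (λ _ → inj₁))
      q∉image x∉𝒜P (inj₂ (inj₁ (p , p≢bot , p⊆x , q∈lhp))) = Escape-⊈ (h-col₁ col-p) escape⊆lhp
        where
        q≡hp : q ≡ h p
        q≡hp = image-part-≡q q∈lhp (λ k lk → inj₂ (inj₁ (p , p≢bot , p⊆x , lk)))
        col-p : col P p ≡ true
        col-p = trans (sym (h-col p)) (subst (λ t → col Q t ≡ true) q≡hp col-q)
        escape⊆lhp : ∀ k → Escape (h p) k → Q.l (h p) k
        escape⊆lhp k esc = subst (λ t → Q.l t k) q≡hp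
          (image⊆lq k (inj₂ (inj₂ (p , col-p , p⊆x , P.⊆ˡ-col₁⇒⊈ˡ x∉𝒜P col-p p⊆x , esc))))
      q∉image _ (inj₂ (inj₂ (p , col-p , p⊆x , x⊈p , inj₁ (s , hp⋖s , q∈ls)))) =
        ≢q-col₀ (Q.⋖-col₁ˡ hp⋖s (h-col₁ col-p))
                (image-part-≡q q∈ls (λ k lk → inj₂ (inj₂ (p , col-p , p⊆x , x⊈p , inj₁ (s , hp⋖s , lk)))))
      q∉image _ (inj₂ (inj₂ (p , col-p , p⊆x , _ , inj₂ (hp-max , q∉lhp)))) =
        q∉lhp (subst (λ t → Q.l t (proj₁ q)) (hp-max q hp⊑q) (Q.l-self (Q.col₁⇒≢bot col-q)))
        where
        hp⊑q : h p Q.⊑ q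
        hp⊑q = Q.l-⊆⇒⊑ (Q.col₁⇒≢bot (h-col₁ col-p))
                       (λ k lk → image⊆lq k (inj₂ (inj₁ (p , P.col₁⇒≢bot col-p , p⊆x , lk))))

  ≼c⇒≤w : P ≼c Q → 𝒜P ≤w 𝒜Q
  ≼c⇒≤w (h , h-mono , h-col) = f , f-continuous , λ x → mk⇔ f-preserves f-reflects
    where open FromEmbedding h h-mono h-col

  module FromReduction (f : Pω → Pω) (f-cont : Continuous f)
                       (f-reduces : ∀ x → 𝒜P x ⇔ 𝒜Q (f x)) where

    χ : Elt α → Pω
    χ p k = ⌊ P.l p k ⌋

    χ≐ˡ : ∀ p → χ p P.≐ˡ p
    χ≐ˡ p k = mk⇔ ⌊⌋-sound ⌊⌋-complete

    χ-col₁ : ∀ {p} → 𝒜P (χ p) → col P p ≡ true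
    χ-col₁ {p} (p′ , col-p′ , χ≐p′) =
      subst (λ t → col P t ≡ true) (sym (P.≐ˡ-unique (P.col₁⇒≢bot col-p′) (χ≐ˡ p) χ≐p′)) col-p′

    y : Elt α → Pω
    y p = f (χ p)

    y-mono : ∀ {p p′} → p P.⊑ p′ → y p ⊆ₚ y p′
    y-mono p⊑p′ = continuous⇒monotone f-cont λ j χpj → ⌊⌋-complete (P.l-mono p⊑p′ (⌊⌋-sound χpj))

    y-𝒜Q : ∀ {p} → col P p ≡ true → 𝒜Q (y p)
    y-𝒜Q {p} col-p = Equivalence.to (f-reduces (χ p)) (p , col-p , χ≐ˡ p)

    ⊆ˡy⇒⊑ : ∀ {p q r} → (∀ k → y p k ≡ true → Q.l q k) → r Q.⊆ˡ y p → r Q.⊑ q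
    ⊆ˡy⇒⊑ {q = q} {r} yp⊆lq r⊆yp with em {r ≡ botQ}
    ... | yes refl = Q.bot-least q
    ... | no r≢bot = Q.l-⊆⇒⊑ r≢bot (λ k lk → yp⊆lq k (r⊆yp k lk))

    bounded : ∀ p → Σ (Elt β) (UpperBound Q (Q._⊆ˡ y p))
    bounded p with P.col₁-above p
    ... | p′ , p⊑p′ , col-p′ with y-𝒜Q col-p′
    ...   | q′ , _ , yp′≐q′ = q′ , λ r → ⊆ˡy⇒⊑ λ k ypk → Equivalence.to (yp′≐q′ k) (y-mono p⊑p′ k ypk)

    σ : Elt α → Elt β
    σ p = proj₁ (Q.lub (Q._⊆ˡ y p) (bounded p))

    σ-ub : ∀ p → UpperBound Q (Q._⊆ˡ y p) (σ p)
    σ-ub p = proj₁ (proj₂ (Q.lub (Q._⊆ˡ y p) (bounded p)))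

    σ-least : ∀ p u → UpperBound Q (Q._⊆ˡ y p) u → σ p Q.⊑ u
    σ-least p = proj₂ (proj₂ (Q.lub (Q._⊆ˡ y p) (bounded p)))

    σ-mono : ∀ {p p′} → p P.⊑ p′ → σ p Q.⊑ σ p′
    σ-mono {p} {p′} p⊑p′ = σ-least p (σ p′) λ r r⊆yp → σ-ub p′ r λ k lk → y-mono p⊑p′ k (r⊆yp k lk)

    σ-≐ˡ : ∀ {p q} → y p Q.≐ˡ q → σ p ≡ q
    σ-≐ˡ {p} {q} yp≐q =
      Q.⊑-antisym (σ-least p q λ r → ⊆ˡy⇒⊑ λ k → Equivalence.to (yp≐q k)) (σ-ub p q (Q.≐ˡ⇒⊆ˡ yp≐q))

    σ-col₁ : ∀ {p} → col P p ≡ true → col Q (σ p) ≡ true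
    σ-col₁ col-p with y-𝒜Q col-p
    ... | q , col-q , yp≐q = subst (λ t → col Q t ≡ true) (sym (σ-≐ˡ yp≐q)) col-q

    σ-col₁-⊆ˡ : ∀ {p} → col Q (σ p) ≡ true → σ p Q.⊆ˡ y p
    σ-col₁-⊆ˡ {p} = Q.col₁-lub-∈ (Q._⊆ˡ y p) bot⊆yp (σ-ub p) (σ-least p)
      where
      bot⊆yp : botQ Q.⊆ˡ y p
      bot⊆yp k (bot≢bot , _) = ⊥-elim (bot≢bot refl)

    -- Otherwise f(l(p)) = l(σ p) = l(σ p′) would lie in 𝒜_Q, so l(p) would lie in 𝒜_P.
    σ-separates : ∀ {p p′} → col P p ≡ false → p P.⊑ p′ → col P p′ ≡ true →
                  col Q (σ p) ≡ true → σ p ≢ σ p′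
    σ-separates {p} {p′} col-p p⊑p′ col-p′ col-σp σp≡σp′ with y-𝒜Q col-p′
    ... | q′ , col-q′ , yp′≐q′ =
      true≢false (trans (sym (χ-col₁ (Equivalence.from (f-reduces (χ p)) (q′ , col-q′ , yp≐q′)))) col-p)
      where
      σp≡q′ : σ p ≡ q′
      σp≡q′ = trans σp≡σp′ (σ-≐ˡ yp′≐q′)
      yp≐q′ : y p Q.≐ˡ q′
      yp≐q′ k = mk⇔ (λ ypk → Equivalence.to (yp′≐q′ k) (y-mono p⊑p′ k ypk))
                    (λ k∈lq′ → σ-col₁-⊆ˡ col-σp k (subst (λ t → Q.l t k) (sym σp≡q′) k∈lq′))

    σ-cover : ∀ {p} → col P p ≡ false → col Q (σ p) ≡ true → ∃[ t ] (σ p Q.⋖ t)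
    σ-cover {p} col-p col-σp =
      let p′ , p⊑p′ , col-p′ = P.col₁-above p
          t , σp⋖t , _ = Q.⋖-above (σ-mono p⊑p′ , σ-separates col-p p⊑p′ col-p′ col-σp)
      in t , σp⋖t

    data Lift (p : Elt α) : Elt β → Set where
      stay : Lift p (σ p)
      step : ∀ {t} → col P p ≡ false → col Q (σ p) ≡ true → σ p Q.⋖ t → Lift p t

    Lift-⊒ : ∀ {p t} → Lift p t → σ p Q.⊑ t
    Lift-⊒ stay = Q.⊑-refl
    Lift-⊒ (step _ _ σp⋖t) = Q.⋖⇒⊑ σp⋖t

    Lift-col₁ : ∀ {p t} → col P p ≡ true → Lift p t → t ≡ σ p
    Lift-col₁ _ stay = refl
    Lift-col₁ col-p (step col-p₀ _ _) = ⊥-elim (true≢false (trans (sym col-p) col-p₀))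

    lift : ∀ p → ∃[ t ] (Lift p t × col Q t ≡ col P p)
    lift p with col P p in col-p
    ... | true = σ p , stay , σ-col₁ col-p
    ... | false with col Q (σ p) in col-σp
    ...   | false = σ p , stay , col-σp
    ...   | true = let t , σp⋖t = σ-cover col-p col-σp in t , step col-p col-σp σp⋖t , Q.⋖-col₁ˡ σp⋖t col-σp

    g : Elt α → Elt β
    g p = proj₁ (lift p)

    g-mono : ∀ p p′ → p P.⊑ p′ → g p Q.⊑ g p′
    g-mono p p′ p⊑p′ with lift p | lift p′
    ... | _ , stay , _ | _ , lift-p′ , _ = Q.⊑-trans (σ-mono p⊑p′) (Lift-⊒ lift-p′)
    ... | _ , step col-p col-σp σp⋖t , _ | t′ , lift-p′ , col-t′ with em {σ p ≡ t′}
    ...   | no σp≢t′ = Q.col₁-⋖-⊑ col-σp σp⋖t (Q.⊑-trans (σ-mono p⊑p′) (Lift-⊒ lift-p′) , σp≢t′)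
    ...   | yes σp≡t′ =
            ⊥-elim (σ-separates col-p p⊑p′ col-p′ col-σp (trans σp≡t′ (Lift-col₁ col-p′ lift-p′)))
      where
      col-p′ : col P p′ ≡ true
      col-p′ = trans (sym col-t′) (subst (λ t → col Q t ≡ true) σp≡t′ col-σp)

  ≤w⇒≼c : 𝒜P ≤w 𝒜Q → P ≼c Q
  ≤w⇒≼c (f , f-cont , f-reduces) = g , g-mono , λ p → proj₂ (proj₂ (lift p))
    where open FromReduction f f-cont f-reduces

corollary34 : ExcludedMiddle 0ℓ →
    (P : CtblPoset) (hP : InPfin P) →
      InDω (𝒜 P (proj₁ hP)) ×
      ((Q : CtblPoset) (hQ : InPfin Q) →
        ((proj₂ P ≼c proj₂ Q) ⇔ (𝒜 P (proj₁ hP) ≤w 𝒜 Q (proj₁ hQ))))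
corollary34 em (α , P) (botP , isFinP) =
  Pfin.𝒜∈Dω em α P botP isFinP ,
  λ { (β , Q) (botQ , isFinQ) →
        let open Reduction em α P botP isFinP β Q botQ isFinQ in mk⇔ ≼c⇒≤w ≤w⇒≼c }
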